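{- Let $m\ge1$ and $n\ge m+2$ be integers. Then $\gamma_{gr}(P_n^m)=n-m$.
   Context: $P_n^m$ is the $m$-th power of the path $P_n$ on $[n]$ (vertices $i,j$ adjacent iff $|i-j|\le m$). For a sequence $S=(v_1,\dots,v_k)$ of distinct vertices, $PN_S(v_i)=N[v_i]\setminus\bigcup_{j<i}N[v_j]$; $S$ is legal dominating if $\{v_1,\dots,v_k\}$ dominates the graph and each $PN_S(v_i)\ne\emptyset$; $\gamma_{gr}$ is the maximum length of such a sequence. -}

module Defs where

open import Data.Nat using (ℕ; _≤_; ∣_-_∣)
open import Data.Fin using (Fin; toℕ)
open import Data.List using (List; []; _∷_; length)
open import Data.List.Membership.Propositional using (_∈_)
open import Data.List.Relation.Unary.Unique.Propositional using (Unique)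
open import Data.Product using (Σ; ∃; _×_)
open import Data.Unit using (⊤)
open import Relation.Nullary using (¬_)
open import Relation.Binary.PropositionalEquality using (_≡_)

-- Vertices of P_n^m: Fin n (vertex i ∈ Fin n stands for i+1 ∈ [n]).
-- u ∈ N[v] in P_n^m  iff  |u - v| ≤ m  (closed neighbourhood).
InN : (m : ℕ) {n : ℕ} → Fin n → Fin n → Set
InN m u v = ∣ toℕ u - toℕ v ∣ ≤ m

HasPN : (m : ℕ) {n : ℕ} → List (Fin n) → Fin n → Set
HasPN m {n} prev v = Σ (Fin n) λ u → InN m u v × (∀ w → w ∈ prev → ¬ InN m u w)

LegalFrom : (m : ℕ) {n : ℕ} → List (Fin n) → List (Fin n) → Set
LegalFrom m prev []       = ⊤
LegalFrom m prev (v ∷ vs) = HasPN m prev v × LegalFrom m (v ∷ prev) vs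

Dominating : (m : ℕ) {n : ℕ} → List (Fin n) → Set
Dominating m {n} S = ∀ (u : Fin n) → ∃ λ v → v ∈ S × InN m u v

LegalDominating : (m : ℕ) {n : ℕ} → List (Fin n) → Set
LegalDominating m S = Unique S × Dominating m S × LegalFrom m [] S

GrundyDomNum≡ : (m n k : ℕ) → Set
GrundyDomNum≡ m n k =
  (Σ (List (Fin n)) λ S → LegalDominating m S × length S ≡ k)
  × (∀ (S : List (Fin n)) → LegalDominating m S → length S ≤ k)

-- Lower bound: the first n − m vertices, in increasing order, form a legal dominating
-- sequence, vertex a having the private neighbour a + m.  Upper bound: the private
-- neighbours of v₂, …, v_k are distinct and lie outside N[v₁], which contains m + 1
-- consecutive vertices, so (k − 1) + (m + 1) ≤ n.
module Submission where

open import Defs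
open import Data.Nat using (ℕ; zero; suc; _≤_; _<_; _+_; _∸_; ∣_-_∣; z≤n; s≤s; z<s; >-nonZero)
open import Data.Nat.Properties
open import Data.Fin as Fin using (Fin; toℕ; fromℕ<)
open import Data.Fin.Properties using (toℕ-fromℕ<; toℕ<n; injective⇒≤)
open import Data.List using (List; []; _∷_; length; lookup; _++_)
open import Data.List.Properties using (length-++)
open import Data.List.Membership.Propositional using (_∈_)
open import Data.List.Membership.Propositional.Properties using (∈-lookup)
open import Data.List.Relation.Unary.Any using (here; there)
open import Data.List.Relation.Unary.All as All using (All; []; _∷_)
open import Data.List.Relation.Unary.AllPairs using ([]; _∷_)
open import Data.List.Relation.Unary.Unique.Propositional using (Unique)
open import Data.List.Relation.Unary.Unique.Propositional.Properties using (++⁺)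
open import Data.List.Relation.Binary.Disjoint.Propositional using (Disjoint)
open import Data.Product using (Σ; ∃; _×_; _,_)
open import Data.Sum using (inj₁; inj₂)
open import Data.Unit using (tt)
open import Data.Empty using (⊥-elim)
open import Function.Definitions using (Injective)
open import Relation.Nullary using (¬_; yes; no)
open import Relation.Binary.PropositionalEquality

private
  variable
    m n a k : ℕ

∣m-n∣≤o⇒m≤n+o : ∀ {o} x y → ∣ x - y ∣ ≤ o → x ≤ y + o
∣m-n∣≤o⇒m≤n+o x y d = ≤-trans (m≤n+∣m-n∣ x y) (+-monoʳ-≤ y d)

m≤n+o∧n≤m+o⇒∣m-n∣≤o : ∀ {o} x y → x ≤ y + o → y ≤ x + o → ∣ x - y ∣ ≤ o
m≤n+o∧n≤m+o⇒∣m-n∣≤o zero    y       _       y≤o     = y≤o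
m≤n+o∧n≤m+o⇒∣m-n∣≤o (suc x) zero    x≤o     _       = x≤o
m≤n+o∧n≤m+o⇒∣m-n∣≤o (suc x) (suc y) (s≤s p) (s≤s q) = m≤n+o∧n≤m+o⇒∣m-n∣≤o x y p q

m≤m∸n+n : ∀ x y → x ≤ x ∸ y + y
m≤m∸n+n x y = subst (x ≤_) (+-comm y (x ∸ y)) (m≤n+m∸n x y)

m∸n+n<o : ∀ {x y o} → x < o → y < o → x ∸ y + y < o
m∸n+n<o {x} {y} {o} x<o y<o with ≤-total x y
... | inj₁ x≤y = subst (λ t → t + y < o) (sym (m≤n⇒m∸n≡0 x≤y)) y<o
... | inj₂ y≤x = subst (_< o) (sym (m∸n+n≡m y≤x)) x<o

lookup-injective : {xs : List (Fin n)} → Unique xs → Injective _≡_ _≡_ (lookup xs)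
lookup-injective (_  ∷ _)  {Fin.zero}  {Fin.zero}  _  = refl
lookup-injective (x∉ ∷ _)  {Fin.zero}  {Fin.suc j} eq = ⊥-elim (All.lookup x∉ (∈-lookup j) eq)
lookup-injective (x∉ ∷ _)  {Fin.suc i} {Fin.zero}  eq = ⊥-elim (All.lookup x∉ (∈-lookup i) (sym eq))
lookup-injective (_  ∷ xs) {Fin.suc i} {Fin.suc j} eq = cong Fin.suc (lookup-injective xs eq)

length-unique≤ : {xs : List (Fin n)} → Unique xs → length xs ≤ n
length-unique≤ xs = injective⇒≤ (lookup-injective xs)

Undominated : (m : ℕ) → List (Fin n) → Fin n → Set
Undominated m prev u = ∀ w → w ∈ prev → ¬ InN m u w

privateNeighbours : (prev vs : List (Fin n)) → LegalFrom m prev vs →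
  Σ (List (Fin n)) λ us → Unique us × length us ≡ length vs × All (Undominated m prev) us
privateNeighbours prev [] tt = [] , [] , refl , []
privateNeighbours {m = m} prev (v ∷ vs) ((u , u∈N[v] , u∉N[prev]) , legal)
  with us , unique , length≡ , us∉N[v∷prev] ← privateNeighbours (v ∷ prev) vs legal =
  u ∷ us , All.map differs us∉N[v∷prev] ∷ unique , cong suc length≡
  , u∉N[prev] ∷ All.map (λ z∉ w w∈ → z∉ w (there w∈)) us∉N[v∷prev]
  where
  differs : ∀ {z} → Undominated m (v ∷ prev) z → u ≢ z
  differs z∉ refl = z∉ v (here refl) u∈N[v]

shift≤ : a + suc k ≤ n → suc a + k ≤ n
shift≤ {a} {k} {n} = subst (_≤ n) (+-suc a k)

interval : (a k : ℕ) → a + k ≤ n → List (Fin n)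
interval a zero    _ = []
interval a (suc k) p = fromℕ< (<-≤-trans (m<m+n a z<s) p) ∷ interval (suc a) k (shift≤ p)

length-interval : ∀ a k (p : a + k ≤ n) → length (interval a k p) ≡ k
length-interval a zero    p = refl
length-interval a (suc k) p = cong suc (length-interval (suc a) k (shift≤ p))

interval-bounds : ∀ a k (p : a + k ≤ n) → All (λ v → a ≤ toℕ v × toℕ v < a + k) (interval a k p)
interval-bounds a zero    p = []
interval-bounds a (suc k) p =
  (≤-reflexive (sym a≡) , subst (_< a + suc k) (sym a≡) (m<m+n a z<s))
  ∷ All.map (λ {v} (a<v , v<) → <⇒≤ a<v , subst (toℕ v <_) (sym (+-suc a k)) v<)
            (interval-bounds (suc a) k (shift≤ p))
  where
  a≡ : toℕ (fromℕ< (<-≤-trans (m<m+n a z<s) p)) ≡ a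
  a≡ = toℕ-fromℕ< _

interval-unique : ∀ a k (p : a + k ≤ n) → Unique (interval a k p)
interval-unique a zero    p = []
interval-unique a (suc k) p =
  All.map (λ (a<v , _) eq → <⇒≢ a<v (trans (sym (toℕ-fromℕ< _)) (cong toℕ eq)))
          (interval-bounds (suc a) k (shift≤ p))
  ∷ interval-unique (suc a) k (shift≤ p)

∈-interval : ∀ a k (p : a + k ≤ n) {x} → a ≤ x → x < a + k →
             ∃ λ v → v ∈ interval a k p × toℕ v ≡ x
∈-interval a zero    p a≤x x<a = ⊥-elim (<⇒≱ x<a (subst (_≤ _) (sym (+-identityʳ a)) a≤x))
∈-interval a (suc k) p {x} a≤x x< with a ≟ x
... | yes refl = _ , here refl , toℕ-fromℕ< _
... | no  a≢x
  with v , v∈ , v≡x ← ∈-interval (suc a) k (shift≤ p) (≤∧≢⇒< a≤x a≢x) (subst (x <_) (+-suc a k) x<)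
  = v , there v∈ , v≡x

legalFrom-interval : ∀ a k (p : a + k ≤ n) {prev : List (Fin n)} → a + k + m ≤ n →
                     All (λ w → toℕ w < a) prev → LegalFrom m prev (interval a k p)
legalFrom-interval a zero    p q before = tt
legalFrom-interval {n} {m} a (suc k) p {prev} q before =
  (fromℕ< a+m<n , a+m∈N[a] , a+m∉N[prev])
  , legalFrom-interval (suc a) k (shift≤ p) (subst (λ t → t + m ≤ n) (+-suc a k) q)
                       (≤-reflexive (cong suc a≡) ∷ All.map m<n⇒m<1+n before)
  where
  a<n : a < n
  a<n = <-≤-trans (m<m+n a z<s) p
  a≡ : toℕ (fromℕ< a<n) ≡ a
  a≡ = toℕ-fromℕ< a<n
  a+m<n : a + m < n
  a+m<n = <-≤-trans (+-monoˡ-< m (m<m+n a z<s)) q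
  a+m≡ : toℕ (fromℕ< a+m<n) ≡ a + m
  a+m≡ = toℕ-fromℕ< a+m<n

  a+m∈N[a] : InN m (fromℕ< a+m<n) (fromℕ< a<n)
  a+m∈N[a] = subst₂ (λ x y → ∣ x - y ∣ ≤ m) (sym a+m≡) (sym a≡)
               (≤-reflexive (trans (∣-∣-comm (a + m) a) (∣m-m+n∣≡n a m)))

  a+m∉N[prev] : Undominated m prev (fromℕ< a+m<n)
  a+m∉N[prev] w w∈ close = <⇒≱ (All.lookup before w∈)
    (+-cancelʳ-≤ m a (toℕ w) (subst (_≤ toℕ w + m) a+m≡ (∣m-n∣≤o⇒m≤n+o _ (toℕ w) close)))

interval-dominating : ∀ k (p : k ≤ n) → 0 < k → n ≤ m + k → Dominating m (interval 0 k p)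
interval-dominating {m = m} k p 0<k n≤m+k u =
  let v , v∈ , v≡ = ∈-interval 0 k p z≤n u∸m<k
  in v , v∈ , subst (λ y → ∣ toℕ u - y ∣ ≤ m) (sym v≡) u∈N[u∸m]
  where
  u∸m<k : toℕ u ∸ m < k
  u∸m<k = m<n+o⇒m∸n<o (toℕ u) m {{>-nonZero 0<k}} (<-≤-trans (toℕ<n u) n≤m+k)
  u∈N[u∸m] : ∣ toℕ u - toℕ u ∸ m ∣ ≤ m
  u∈N[u∸m] = m≤n+o∧n≤m+o⇒∣m-n∣≤o (toℕ u) (toℕ u ∸ m) (m≤m∸n+n (toℕ u) m)
    (≤-trans (m∸n≤m (toℕ u) m) (m≤m+n (toℕ u) m))

window-fits : (v : Fin n) → m < n → toℕ v ∸ m + suc m ≤ n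
window-fits {n} {m} v m<n = subst (_≤ n) (sym (+-suc (toℕ v ∸ m) m)) (m∸n+n<o (toℕ<n v) m<n)

window : (v : Fin n) → m < n → List (Fin n)
window {m = m} v m<n = interval (toℕ v ∸ m) (suc m) (window-fits v m<n)

window-⊆-N : (v : Fin n) (m<n : m < n) → All (λ u → InN m u v) (window v m<n)
window-⊆-N {m = m} v m<n = All.map close (interval-bounds (toℕ v ∸ m) (suc m) (window-fits v m<n))
  where
  close : ∀ {u} → toℕ v ∸ m ≤ toℕ u × toℕ u < toℕ v ∸ m + suc m → InN m u v
  close {u} (lo , hi) = m≤n+o∧n≤m+o⇒∣m-n∣≤o (toℕ u) (toℕ v)
    (≤-trans (+-cancelˡ-≤ 1 _ _ (subst (toℕ u <_) (+-suc (toℕ v ∸ m) m) hi))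
             (+-monoˡ-≤ m (m∸n≤m (toℕ v) m)))
    (≤-trans (m≤m∸n+n (toℕ v) m) (+-monoˡ-≤ m lo))

length-disjoint-++≤ : {xs ys : List (Fin n)} → Unique xs → Unique ys → Disjoint xs ys →
                      length xs + length ys ≤ n
length-disjoint-++≤ {xs = xs} xs! ys! xs#ys =
  subst (_≤ _) (length-++ xs) (length-unique≤ (++⁺ xs! ys! xs#ys))

window-disjoint : {us : List (Fin n)} (v : Fin n) (m<n : m < n) →
                  All (Undominated m (v ∷ [])) us → Disjoint us (window v m<n)
window-disjoint v m<n us∉N[v] (u∈us , u∈W) =
  All.lookup us∉N[v] u∈us v (here refl) (All.lookup (window-⊆-N v m<n) u∈W)

legal-length+m≤n : m < n → (S : List (Fin n)) → LegalFrom m [] S → length S + m ≤ n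
legal-length+m≤n m<n [] _ = <⇒≤ m<n
legal-length+m≤n {m} {n} m<n (v ∷ vs) (_ , legal)
  with us , us! , |us|≡|vs| , us∉N[v] ← privateNeighbours (v ∷ []) vs legal = begin
    suc (length vs) + m                ≡⟨ sym (+-suc (length vs) m) ⟩
    length vs + suc m                  ≡⟨ sym (cong₂ _+_ |us|≡|vs| (length-interval _ (suc m) _)) ⟩
    length us + length (window v m<n)  ≤⟨ length-disjoint-++≤ us! (interval-unique _ (suc m) _)
                                                            (window-disjoint v m<n us∉N[v]) ⟩
    n                                  ∎
  where open ≤-Reasoning

corollary2 : (m n : ℕ) → 1 ≤ m → m + 2 ≤ n → GrundyDomNum≡ m n (n ∸ m)
corollary2 m n _ m+2≤n =
  (S , (interval-unique 0 (n ∸ m) n∸m≤n , dominating , legal) , length-interval 0 (n ∸ m) n∸m≤n)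
  , maximal
  where
  m<n : m < n
  m<n = <-≤-trans (m<m+n m z<s) m+2≤n
  m≤n : m ≤ n
  m≤n = <⇒≤ m<n
  n∸m≤n : n ∸ m ≤ n
  n∸m≤n = m∸n≤m n m
  S : List (Fin n)
  S = interval 0 (n ∸ m) n∸m≤n
  dominating : Dominating m S
  dominating = interval-dominating (n ∸ m) n∸m≤n (m<n⇒0<n∸m m<n) (≤-reflexive (sym (m+[n∸m]≡n m≤n)))
  legal : LegalFrom m [] S
  legal = legalFrom-interval 0 (n ∸ m) n∸m≤n (≤-reflexive (m∸n+n≡m m≤n)) []
  maximal : ∀ T → LegalDominating m T → length T ≤ n ∸ m
  maximal T (_ , _ , legalT) = m+n≤o⇒m≤o∸n (length T) (legal-length+m≤n m<n T legalT)
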